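{- If finite digraphs $G$ and $H$ do not have the same tally-spectra, then $\forall$ has a winning strategy in the Seurat game $\mathbf{G}^2(G,H)$.
   Context: Digraphs: finite vertex set $V$ with edges $E\subseteq V\times V$ (loops allowed). For a vertex $v$ and $Y\subseteq V$: $\tau_Y(v)=(|E\cap(Y\times\{v\})|,|E\cap(\{v\}\times Y)|)$. The tally-sequence $\vec\tau(v)=(t^v_0,t^v_1,\ldots)$ is defined recursively for all vertices simultaneously: $t^v_0=\tau_V(v)$, and $t^v_{k+1}=\tau_{X^v_k}(v)$ where $X^v_k=\{u\in V:(t^u_0,\ldots,t^u_k)=(t^v_0,\ldots,t^v_k)\}$. The tally-spectrum of a digraph is the multiset of tally-sequences of its vertices. Seurat game $\mathbf{G}^k(G,H)$: two players $\forall,\exists$, a set $\mathbf{Col}$ of $k$ colours. A position is a pair of functions $g:\mathbf{Col}\to\wp(G)$, $h:\mathbf{Col}\to\wp(H)$, initially all empty. In each of $\omega$ rounds $\forall$ chooses a colour $c$, one of the graphs and a subset of its vertices; $\exists$ then chooses a subset of the other graph; $c$ is then assigned these two sets (erasing its previous use). The palette of a vertex is the set of colours whose set contains it; $P^G$ is the set of vertices of $G$ with palette exactly $P$. $\forall$ wins in round $n$ if at its beginning (C1) some palette $P$ has $P^G$ empty and $P^H$ nonempty or vice versa, or (C2) there are palettes $P_1,P_2$ with an edge from $P_1^G$ to $P_2^G$ but none from $P_1^H$ to $P_2^H$, or vice versa. $\forall$ has a winning strategy if he can guarantee a win in finitely many rounds. -}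

module Defs where

open import Data.Nat using (ℕ; zero; suc; _+_)
open import Data.Nat.Properties using () renaming (_≟_ to _≟ℕ_)
open import Data.Bool using (Bool; true; false; if_then_else_; _∧_)
open import Data.Fin using (Fin)
open import Data.List using (List; map)
open import Data.Nat.ListAction using (sum)
open import Data.List using () renaming (allFin to allFinL)
open import Data.Vec using (Vec; _∷_; [_]; head)
import Data.Vec.Properties as VP
import Data.Product.Properties as PP
open import Data.Product using (_×_; _,_; Σ; ∃; ∃-syntax)
open import Data.Sum using (_⊎_)
open import Relation.Nullary using (¬_; does)
open import Relation.Binary.PropositionalEquality using (_≡_)
open import Function.Bundles using (_↔_; Inverse)

-- Finite digraphs: vertex set Fin n, edge relation E (loops allowed).
-- E u v ≡ true means (u , v) ∈ E.

record Digraph : Set where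
  constructor digraph
  field
    size : ℕ
    E    : Fin size → Fin size → Bool
open Digraph public

V : Digraph → Set
V G = Fin (size G)

count : (G : Digraph) → (V G → Bool) → ℕ
count G p = sum (map (λ u → if p u then 1 else 0) (allFinL (size G)))

τ : (G : Digraph) → (V G → Bool) → V G → ℕ × ℕ
τ G Y v = count G (λ u → Y u ∧ E G u v) , count G (λ u → Y u ∧ E G v u)

_≟²_ : (a b : ℕ × ℕ) → Relation.Nullary.Dec (a ≡ b)
_≟²_ = PP.≡-dec _≟ℕ_ _≟ℕ_

-- prefix G k v = (t^v_k , t^v_{k-1} , … , t^v_0)  (stored in reverse order)
prefix : (G : Digraph) → (k : ℕ) → V G → Vec (ℕ × ℕ) (suc k)
prefix G zero    v = [ τ G (λ _ → true) v ]
prefix G (suc k) v =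
  τ G (λ u → does (VP.≡-dec _≟²_ (prefix G k u) (prefix G k v))) v
    ∷ prefix G k v

tallySeq : (G : Digraph) → V G → ℕ → ℕ × ℕ
tallySeq G v k = head (prefix G k v)

-- G and H have the same tally-spectrum (equal multisets of tally-sequences):
-- a bijection between the vertex sets preserving tally-sequences.
SameTallySpectrum : Digraph → Digraph → Set
SameTallySpectrum G H =
  Σ (V G ↔ V H) λ π → ∀ v k → tallySeq G v k ≡ tallySeq H (Inverse.to π v) k

Subset : Digraph → Set
Subset G = V G → Bool

record Position (k : ℕ) (G H : Digraph) : Set where
  constructor pos
  field
    g : Fin k → Subset G
    h : Fin k → Subset H
open Position public

initial : ∀ {k G H} → Position k G H
initial = pos (λ _ _ → false) (λ _ _ → false)

Palette : ℕ → Set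
Palette k = Fin k → Bool

HasPalette : ∀ {k} (G : Digraph) → (Fin k → Subset G) → V G → Palette k → Set
HasPalette G col v P = ∀ c → col c v ≡ P c

Occurs : ∀ {k} (G : Digraph) → (Fin k → Subset G) → Palette k → Set
Occurs G col P = ∃[ v ] HasPalette G col v P

EdgeBetween : ∀ {k} (G : Digraph) → (Fin k → Subset G) → Palette k → Palette k → Set
EdgeBetween G col P₁ P₂ =
  ∃[ u ] ∃[ v ] (E G u v ≡ true × HasPalette G col u P₁ × HasPalette G col v P₂)

ForallWinsAt : ∀ {k G H} → Position k G H → Set
ForallWinsAt {k} {G} {H} p =
    (∃[ P ] ((¬ Occurs G (g p) P × Occurs H (h p) P)
           ⊎ (Occurs G (g p) P × ¬ Occurs H (h p) P)))
  ⊎ (∃[ P₁ ] ∃[ P₂ ] ((EdgeBetween G (g p) P₁ P₂ × ¬ EdgeBetween H (h p) P₁ P₂)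
                    ⊎ (¬ EdgeBetween G (g p) P₁ P₂ × EdgeBetween H (h p) P₁ P₂)))

open import Data.Fin using (_≟_)

assign : ∀ {k} {A : Set} → (Fin k → A) → Fin k → A → (Fin k → A)
assign f c a c' = if does (c' ≟ c) then a else f c'

-- ∀ chooses colour c and a subset S of G (resp. H); ∃ answers with T in H (resp. G)
moveG : ∀ {k G H} → Position k G H → Fin k → Subset G → Subset H → Position k G H
moveG p c S T = pos (assign (g p) c S) (assign (h p) c T)

moveH : ∀ {k G H} → Position k G H → Fin k → Subset H → Subset G → Position k G H
moveH p c S T = pos (assign (g p) c T) (assign (h p) c S)

-- ∀ has a strategy from position p that guarantees a win after finitely
-- many rounds (well-founded inductive game tree).
data ForallWins {k G H} (p : Position k G H) : Set where
  won   : ForallWinsAt p → ForallWins p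
  playG : (c : Fin k) (S : Subset G) → (∀ T → ForallWins (moveG p c S T)) → ForallWins p
  playH : (c : Fin k) (S : Subset H) → (∀ T → ForallWins (moveH p c S T)) → ForallWins p

ForallHasWinningStrategy : ℕ → Digraph → Digraph → Set
ForallHasWinningStrategy k G H = ForallWins {k} {G} {H} initial

-- With two colours, ∀ can keep a pair (X , Y) of sets in one colour while
-- moving with the other. From such a pair he wins whenever |X| ≠ |Y|, and he
-- can make ∃ follow him vertex by vertex, so it suffices to distinguish single
-- vertices t ∈ G and w ∈ H. By induction on k he distinguishes t and w whose
-- tally prefixes of length k differ: if they agree before k but t has more (or
-- fewer) in- or out-neighbours in its class, he paints that neighbourhood
-- together with everything outside the class, and every answer of ∃ either
-- shows an unmatched palette or edge, or leaves sets of different sizes, or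
-- pins down two vertices distinguished earlier. The tally refinement
-- stabilises after finitely many steps, so if the spectra differ then some
-- prefix class has different sizes in G and H, and ∀ wins by painting it.

module Submission where

open import Defs
open import Relation.Nullary using (¬_)

import Data.Nat.Properties as ℕ
open import Algebra.Properties.CommutativeMonoid.Sum ℕ.+-0-commutativeMonoid
  using (sum; sum-cong-≗; sum-remove; sum-replicate-zero; ∑-distrib-+)
open import Data.Bool using (Bool; true; false; if_then_else_; _∧_; not)
open import Data.Bool.Properties
  using (not-involutive; not-injective; not-¬; ¬-not; ∧-conicalˡ; ∧-zeroʳ; ∧-identityʳ)
  renaming (_≟_ to _≟ᵇ_)
open import Data.Empty using (⊥; ⊥-elim)
open import Data.Fin using (Fin; zero; suc; punchIn)
import Data.Fin.Permutation as Permutation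
open import Data.Fin.Properties using (punchInᵢ≢i) renaming (_≟_ to _≟ᶠ_)
open import Data.List using (tabulate)
open import Data.List.Properties using (map-tabulate)
open import Data.Nat using (ℕ; zero; suc; _+_; _∸_; _≤_; _<_; _≤?_; z≤n; s≤s)
import Data.Nat.ListAction as List
open import Data.Product using (_×_; _,_; Σ; ∃; proj₁; proj₂)
open import Data.Sum using (_⊎_; inj₁; inj₂)
import Data.Sum as Sum
open import Data.Vec using (Vec; _∷_; [_]; head)
open import Data.Vec.Properties as Vec using (∷-injectiveˡ; ∷-injectiveʳ)
open import Function.Base using (_∘_; id; flip)
open import Function.Bundles using (_↔_; Inverse)
open import Function.Construct.Identity using (↔-id)
open import Relation.Binary.Definitions using (DecidableEquality; tri<; tri≈; tri>)
open import Relation.Binary.PropositionalEquality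
  using (_≡_; _≢_; _≗_; refl; sym; trans; cong; cong₂; cong-app; subst; subst₂; module ≡-Reasoning)
open import Relation.Nullary using (Dec; yes; no; does)
open import Relation.Nullary.Decidable using (dec-true; dec-false; toSum)

does≡true⇒ : ∀ {P : Set} (P? : Dec P) → does P? ≡ true → P
does≡true⇒ (yes p) _  = p
does≡true⇒ (no _)  ()

false≢true : false ≢ true
false≢true ()

some-or-all : ∀ n {B C : Fin n → Set} → (∀ i → B i ⊎ C i) → Σ (Fin n) B ⊎ (∀ i → C i)
some-or-all zero    _ = inj₂ λ ()
some-or-all (suc n) B⊎C with B⊎C zero | some-or-all n (B⊎C ∘ suc)
... | inj₁ b | _             = inj₁ (zero , b)
... | inj₂ _ | inj₁ (i , b)  = inj₁ (suc i , b)
... | inj₂ c | inj₂ cs       = inj₂ λ { zero → c ; (suc i) → cs i }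

_⊆_ : ∀ {n} → (Fin n → Bool) → (Fin n → Bool) → Set
p ⊆ q = ∀ i → p i ≡ true → q i ≡ true

⁅_⁆ : ∀ {n} → Fin n → Fin n → Bool
⁅ t ⁆ u = does (u ≟ᶠ t)

bit : Bool → ℕ
bit b = if b then 1 else 0

∣_∣ : ∀ {n} → (Fin n → Bool) → ℕ
∣ p ∣ = sum (bit ∘ p)

module _ {n : ℕ} where

  ⁅⁆-self : (t : Fin n) → ⁅ t ⁆ t ≡ true
  ⁅⁆-self t = dec-true (t ≟ᶠ t) refl

  ⁅⁆-≡ : {t u : Fin n} → ⁅ t ⁆ u ≡ true → u ≡ t
  ⁅⁆-≡ {t} {u} = does≡true⇒ (u ≟ᶠ t)

  ⊆⁅⁆⇒≗ : {p : Fin n → Bool} {y : Fin n} → p ⊆ ⁅ y ⁆ → p y ≡ true → p ≗ ⁅ y ⁆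
  ⊆⁅⁆⇒≗ {y = y} p⊆y py u with u ≟ᶠ y
  ... | yes refl = py
  ... | no u≢y   = ¬-not λ pu → u≢y (⁅⁆-≡ (p⊆y u pu))

  ⊆-or-escape : (p q : Fin n → Bool) → p ⊆ q ⊎ ∃ λ i → p i ≡ true × q i ≡ false
  ⊆-or-escape p q = Sum.swap (some-or-all n λ i → escape-or-⇒ (p i) (q i))
    where
    escape-or-⇒ : ∀ a b → (a ≡ true × b ≡ false) ⊎ (a ≡ true → b ≡ true)
    escape-or-⇒ false _     = inj₂ λ ()
    escape-or-⇒ true  true  = inj₂ λ _ → refl
    escape-or-⇒ true  false = inj₁ (refl , refl)

  ≗-or-differ : (p q : Fin n → Bool) → p ≗ q ⊎ ∃ λ i → p i ≢ q i
  ≗-or-differ p q = Sum.swap (some-or-all n λ i → Sum.swap (toSum (p i ≟ᵇ q i)))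

  empty-or-inhabited : (p : Fin n → Bool) → (∀ i → p i ≡ false) ⊎ ∃ λ i → p i ≡ true
  empty-or-inhabited p with ⊆-or-escape p (λ _ → false)
  ... | inj₁ p⊆∅          = inj₁ λ i → ¬-not λ pi → false≢true (p⊆∅ i pi)
  ... | inj₂ (i , pi , _) = inj₂ (i , pi)

sum-tabulate : ∀ n (f : Fin n → ℕ) → List.sum (tabulate f) ≡ sum f
sum-tabulate zero    f = refl
sum-tabulate (suc n) f = cong (f zero +_) (sum-tabulate n (f ∘ suc))

count≡∣∣ : ∀ G (p : Subset G) → count G p ≡ ∣ p ∣
count≡∣∣ G p = trans (cong List.sum (map-tabulate id (bit ∘ p))) (sum-tabulate (size G) (bit ∘ p))

sum-mono-≤ : ∀ {n} {f g : Fin n → ℕ} → (∀ i → f i ≤ g i) → sum f ≤ sum g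
sum-mono-≤ {zero}  _   = z≤n
sum-mono-≤ {suc n} f≤g = ℕ.+-mono-≤ (f≤g zero) (sum-mono-≤ (f≤g ∘ suc))

sum-mono-< : ∀ {n} {f g : Fin n → ℕ} → (∀ i → f i ≤ g i) → ∀ i → f i < g i → sum f < sum g
sum-mono-< f≤g zero    fi<gi = ℕ.+-mono-<-≤ fi<gi (sum-mono-≤ (f≤g ∘ suc))
sum-mono-< f≤g (suc i) fi<gi = ℕ.+-mono-≤-< (f≤g zero) (sum-mono-< (f≤g ∘ suc) i fi<gi)

bit-mono : ∀ {a b} → (a ≡ true → b ≡ true) → bit a ≤ bit b
bit-mono {false} _   = z≤n
bit-mono {true}  a⇒b rewrite a⇒b refl = ℕ.≤-refl

module _ {n : ℕ} where

  ∣∣-cong : {p q : Fin n → Bool} → p ≗ q → ∣ p ∣ ≡ ∣ q ∣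
  ∣∣-cong p≗q = sum-cong-≗ (cong bit ∘ p≗q)

  ∣∣-mono : {p q : Fin n → Bool} → p ⊆ q → ∣ p ∣ ≤ ∣ q ∣
  ∣∣-mono p⊆q = sum-mono-≤ (bit-mono ∘ p⊆q)

  ∣∣-mono-< : {p q : Fin n → Bool} → p ⊆ q → ∀ i → p i ≡ false → q i ≡ true → ∣ p ∣ < ∣ q ∣
  ∣∣-mono-< p⊆q i pi qi =
    sum-mono-< (bit-mono ∘ p⊆q) i (subst₂ (λ a b → bit a < bit b) (sym pi) (sym qi) (s≤s z≤n))

  ∣∣-empty : {p : Fin n → Bool} → (∀ i → p i ≡ false) → ∣ p ∣ ≡ 0
  ∣∣-empty p≡false = trans (sum-cong-≗ (cong bit ∘ p≡false)) (sum-replicate-zero n)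

  ∣∣-nonempty : (p : Fin n → Bool) → ∀ i → p i ≡ true → 0 < ∣ p ∣
  ∣∣-nonempty p i pi =
    subst (_< ∣ p ∣) (∣∣-empty {λ _ → false} (λ _ → refl)) (∣∣-mono-< (λ _ ()) i refl pi)

  ∣∣-split : (p q : Fin n → Bool) → ∣ p ∣ ≡ ∣ (λ i → p i ∧ q i) ∣ + ∣ (λ i → p i ∧ not (q i)) ∣
  ∣∣-split p q = trans (sum-cong-≗ λ i → bit-split (p i) (q i))
                       (∑-distrib-+ (λ i → bit (p i ∧ q i)) (λ i → bit (p i ∧ not (q i))))
    where
    bit-split : ∀ a b → bit a ≡ bit (a ∧ b) + bit (a ∧ not b)
    bit-split false _     = refl
    bit-split true  false = refl
    bit-split true  true  = refl

_∖⁅_⁆ : ∀ {n} → (Fin n → Bool) → Fin n → Fin n → Bool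
(p ∖⁅ y ⁆) u = p u ∧ not (⁅ y ⁆ u)

∖⁅⁆-self : ∀ {n} (p : Fin n → Bool) y → (p ∖⁅ y ⁆) y ≡ false
∖⁅⁆-self p y = trans (cong (λ b → p y ∧ not b) (⁅⁆-self y)) (∧-zeroʳ (p y))

∣∣-remove : ∀ {n} (p : Fin n → Bool) y → p y ≡ true → ∣ p ∣ ≡ suc ∣ p ∖⁅ y ⁆ ∣
∣∣-remove {suc n} p y py = begin
  ∣ p ∣                   ≡⟨ sum-remove {i = y} (bit ∘ p) ⟩
  bit (p y) + rest p      ≡⟨ cong₂ _+_ (cong bit py) (sum-cong-≗ (cong bit ∘ away-from-y)) ⟩
  suc (rest (p ∖⁅ y ⁆))   ≡⟨ cong suc (sym (trans (sum-remove {i = y} (bit ∘ (p ∖⁅ y ⁆)))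
                                                (cong (λ b → bit b + rest (p ∖⁅ y ⁆)) (∖⁅⁆-self p y)))) ⟩
  suc ∣ p ∖⁅ y ⁆ ∣        ∎
  where
  open ≡-Reasoning
  rest : (Fin (suc n) → Bool) → ℕ
  rest q = sum (bit ∘ q ∘ punchIn y)

  away-from-y : ∀ i → p (punchIn y i) ≡ (p ∖⁅ y ⁆) (punchIn y i)
  away-from-y i = sym (trans (cong (λ b → p (punchIn y i) ∧ not b)
                                   (dec-false (punchIn y i ≟ᶠ y) (punchInᵢ≢i y i)))
                             (∧-identityʳ (p (punchIn y i))))

-- The two-colour game

other : Fin 2 → Fin 2
other zero       = suc zero
other (suc zero) = zero

assign-other : ∀ {A : Set} c (f : Fin 2 → A) a → assign f (other c) a c ≡ f c
assign-other zero       f a = refl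
assign-other (suc zero) f a = refl

assign-self : ∀ {A : Set} c (f : Fin 2 → A) a → assign f (other c) a (other c) ≡ a
assign-self zero       f a = refl
assign-self (suc zero) f a = refl

record Shows {G H : Digraph} (q : Position 2 G H) (c : Fin 2)
             (X : Subset G) (Y : Subset H) (S : Subset G) (T : Subset H) : Set where
  field
    gX : g q c ≗ X
    hY : h q c ≗ Y
    gS : g q (other c) ≗ S
    hT : h q (other c) ≗ T
open Shows

ImmediateWin : (G H : Digraph) → Subset G → Subset H → Subset G → Subset H → Set
ImmediateWin G H X Y S T = ∀ q c → Shows {G} {H} q c X Y S T → ForallWinsAt q

-- One colour holds (X , Y); the other one is free for ∀'s next move.
WinsFrom : (G H : Digraph) → Subset G → Subset H → Set
WinsFrom G H X Y = ∀ c (p : Position 2 G H) → g p c ≗ X → h p c ≗ Y → ForallWins p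

Distinguishable : (G H : Digraph) → V G → V H → Set
Distinguishable G H t w = WinsFrom G H ⁅ t ⁆ ⁅ w ⁆

WinsFrom-cong : ∀ {G H X X′ Y Y′} → WinsFrom G H X Y → X ≗ X′ → Y ≗ Y′ → WinsFrom G H X′ Y′
WinsFrom-cong win X≗X′ Y≗Y′ c p pX pY =
  win c p (λ v → trans (pX v) (sym (X≗X′ v))) (λ w → trans (pY w) (sym (Y≗Y′ w)))

swap : ∀ {k G H} → Position k G H → Position k H G
swap p = pos (h p) (g p)

ForallWinsAt-swap : ∀ {k G H} {p : Position k G H} → ForallWinsAt p → ForallWinsAt (swap p)
ForallWinsAt-swap (inj₁ (P , inj₁ (a , b)))       = inj₁ (P , inj₂ (b , a))
ForallWinsAt-swap (inj₁ (P , inj₂ (a , b)))       = inj₁ (P , inj₁ (b , a))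
ForallWinsAt-swap (inj₂ (P₁ , P₂ , inj₁ (a , b))) = inj₂ (P₁ , P₂ , inj₂ (b , a))
ForallWinsAt-swap (inj₂ (P₁ , P₂ , inj₂ (a , b))) = inj₂ (P₁ , P₂ , inj₁ (b , a))

ForallWins-swap : ∀ {k G H} {p : Position k G H} → ForallWins p → ForallWins (swap p)
ForallWins-swap (won w)           = won (ForallWinsAt-swap w)
ForallWins-swap (playG c S next) = playH c S (ForallWins-swap ∘ next)
ForallWins-swap (playH c S next) = playG c S (ForallWins-swap ∘ next)

ImmediateWin-sym : ∀ {G H X Y S T} → ImmediateWin G H X Y S T → ImmediateWin H G Y X T S
ImmediateWin-sym win q c r =
  ForallWinsAt-swap (win (swap q) c record { gX = hY r ; hY = gX r ; gS = hT r ; hT = gS r })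

WinsFrom-sym : ∀ {G H X Y} → WinsFrom G H X Y → WinsFrom H G Y X
WinsFrom-sym win c p pY pX = ForallWins-swap (win c (swap p) pX pY)

Distinguishable-sym : ∀ {G H t w} → Distinguishable G H t w → Distinguishable H G w t
Distinguishable-sym = WinsFrom-sym

module _ {G H : Digraph} {X : Subset G} {Y : Subset H} {S : Subset G} {T : Subset H} where

  unmatched-vertexᴳ : (v : V G) → (∀ w → X v ≡ Y w → S v ≡ T w → ⊥) → ImmediateWin G H X Y S T
  unmatched-vertexᴳ v unmatched q c r =
    inj₁ (_ , inj₂ ((v , λ _ → refl) , λ (w , same) →
      unmatched w (agree c (gX r) (hY r) w same) (agree (other c) (gS r) (hT r) w same)))
    where
    agree : ∀ d {Z : Subset G} {Z′ : Subset H} → g q d ≗ Z → h q d ≗ Z′ →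
            ∀ w → HasPalette H (h q) w (λ d′ → g q d′ v) → Z v ≡ Z′ w
    agree d gZ hZ′ w same = trans (sym (gZ v)) (trans (sym (same d)) (hZ′ w))

  unmatched-edgeᴴ : (u v : V H) → E H u v ≡ true →
                    (∀ u′ v′ → X u′ ≡ Y u → S u′ ≡ T u → X v′ ≡ Y v → S v′ ≡ T v → E G u′ v′ ≡ true → ⊥) →
                    ImmediateWin G H X Y S T
  unmatched-edgeᴴ u v uv unmatched q c r =
    inj₂ (_ , _ , inj₂ ((λ (u′ , v′ , u′v′ , u′-like-u , v′-like-v) →
        unmatched u′ v′ (agree c (gX r) (hY r) u′-like-u) (agree (other c) (gS r) (hT r) u′-like-u)
                        (agree c (gX r) (hY r) v′-like-v) (agree (other c) (gS r) (hT r) v′-like-v) u′v′) ,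
      (u , v , uv , (λ _ → refl) , (λ _ → refl))))
    where
    agree : ∀ d {Z : Subset G} {Z′ : Subset H} {x v′} → g q d ≗ Z → h q d ≗ Z′ →
            HasPalette G (g q) v′ (λ d′ → h q d′ x) → Z v′ ≡ Z′ x
    agree d {x = x} {v′} gZ hZ′ same = trans (sym (gZ v′)) (trans (same d) (hZ′ x))

unmatched-vertexᴴ : ∀ {G H X Y S T} (w : V H) → (∀ v → X v ≡ Y w → S v ≡ T w → ⊥) → ImmediateWin G H X Y S T
unmatched-vertexᴴ w unmatched =
  ImmediateWin-sym (unmatched-vertexᴳ w λ v Yw≡Xv Tw≡Sv → unmatched v (sym Yw≡Xv) (sym Tw≡Sv))

paintᴳ : ∀ {G H X Y} (S : Subset G) → (∀ T → ImmediateWin G H X Y S T ⊎ WinsFrom G H S T) → WinsFrom G H X Y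
paintᴳ S reply c p pX pY = playG (other c) S respond
  where
  respond : ∀ T → ForallWins (moveG p (other c) S T)
  respond T with reply T
  ... | inj₁ win = won (win _ c record
    { gX = λ v → trans (cong-app (assign-other c (g p) S) v) (pX v)
    ; hY = λ w → trans (cong-app (assign-other c (h p) T) w) (pY w)
    ; gS = cong-app (assign-self c (g p) S)
    ; hT = cong-app (assign-self c (h p) T) })
  ... | inj₂ win = win (other c) _ (cong-app (assign-self c (g p) S)) (cong-app (assign-self c (h p) T))

paintᴴ : ∀ {G H X Y} (S : Subset H) → (∀ T → ImmediateWin G H X Y T S ⊎ WinsFrom G H T S) → WinsFrom G H X Y
paintᴴ S reply = WinsFrom-sym (paintᴳ S (Sum.map ImmediateWin-sym WinsFrom-sym ∘ reply))

-- ∀ paints Y minus one point; ∃ must answer with a proper subset of X.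
∣∣<⇒wins : ∀ {G H} n {X : Subset G} {Y : Subset H} → ∣ X ∣ < n → ∣ X ∣ < ∣ Y ∣ → WinsFrom G H X Y
∣∣<⇒wins zero X<0 _ = ⊥-elim (ℕ.n≮0 X<0)
∣∣<⇒wins {G} {H} (suc n) {X} {Y} X<1+n X<Y with empty-or-inhabited Y
... | inj₁ Y-empty  = ⊥-elim (ℕ.n≮0 (subst (∣ X ∣ <_) (∣∣-empty Y-empty) X<Y))
... | inj₂ (y , Yy) = paintᴴ S respond
  where
  S : Subset H
  S = Y ∖⁅ y ⁆

  X≤S : ∣ X ∣ ≤ ∣ S ∣
  X≤S = ℕ.≤-pred (subst (∣ X ∣ <_) (∣∣-remove Y y Yy) X<Y)

  recurse : ∀ {T} → ∣ T ∣ < ∣ X ∣ → WinsFrom G H T S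
  recurse T<X = ∣∣<⇒wins n (ℕ.<-≤-trans T<X (ℕ.≤-pred X<1+n)) (ℕ.<-≤-trans T<X X≤S)

  respond : ∀ T → ImmediateWin G H X Y T S ⊎ WinsFrom G H T S
  respond T with ⊆-or-escape T X
  ... | inj₂ (v , v∈T , v∉X) = inj₁ (unmatched-vertexᴳ v λ w Xv≡Yw Tv≡Sw →
          false≢true (trans (sym v∉X) (trans Xv≡Yw (∧-conicalˡ _ _ (trans (sym Tv≡Sw) v∈T)))))
  ... | inj₁ T⊆X with ⊆-or-escape X T
  ...   | inj₁ X⊆T              = inj₁ (unmatched-vertexᴴ y λ v Xv≡Yy Tv≡Sy →
          false≢true (trans (sym (∖⁅⁆-self Y y)) (trans (sym Tv≡Sy) (X⊆T v (trans Xv≡Yy Yy)))))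
  ...   | inj₂ (x , x∈X , x∉T)  = inj₂ (recurse (∣∣-mono-< T⊆X x x∉T x∈X))

∣∣≢⇒wins : ∀ {G H} {X : Subset G} {Y : Subset H} → ∣ X ∣ ≢ ∣ Y ∣ → WinsFrom G H X Y
∣∣≢⇒wins {X = X} {Y} X≢Y with ℕ.<-cmp ∣ X ∣ ∣ Y ∣
... | tri< X<Y _ _ = ∣∣<⇒wins _ (ℕ.n<1+n _) X<Y
... | tri≈ _ X≡Y _ = ⊥-elim (X≢Y X≡Y)
... | tri> _ _ Y<X = WinsFrom-sym (∣∣<⇒wins _ (ℕ.n<1+n _) Y<X)

wins-complement : ∀ {G H} {X : Subset G} {Y : Subset H} → WinsFrom G H (not ∘ X) (not ∘ Y) → WinsFrom G H X Y
wins-complement {X = X} {Y} win = paintᴳ (not ∘ X) respond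
  where
  respond : ∀ T → ImmediateWin _ _ X Y (not ∘ X) T ⊎ WinsFrom _ _ (not ∘ X) T
  respond T with ≗-or-differ T (not ∘ Y)
  ... | inj₁ T≗¬Y        = inj₂ (WinsFrom-cong win (λ _ → refl) (sym ∘ T≗¬Y))
  ... | inj₂ (w , Tw≢¬Yw) = inj₁ (unmatched-vertexᴴ w λ v Xv≡Yw ¬Xv≡Tw →
          not-¬ refl (sym (trans ¬Xv≡Tw (trans (trans (¬-not Tw≢¬Yw) (not-involutive (Y w))) (sym Xv≡Yw)))))

select-pointᴳ : ∀ {G H} {T : Subset G} {t : V G} {w : V H} → T t ≡ true →
                Distinguishable G H t w → WinsFrom G H T ⁅ w ⁆
select-pointᴳ {G} {H} {T} {t} {w} Tt t≁w = paintᴳ ⁅ t ⁆ respond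
  where
  respond : ∀ R → ImmediateWin G H T ⁅ w ⁆ ⁅ t ⁆ R ⊎ WinsFrom G H ⁅ t ⁆ R
  respond R with ⊆-or-escape R ⁅ w ⁆
  ... | inj₂ (w′ , w′∈R , w′≢w) = inj₁ (unmatched-vertexᴴ w′ λ v Tv≡⁅w⁆w′ ⁅t⁆v≡Rw′ →
          let v≡t = ⁅⁆-≡ (trans ⁅t⁆v≡Rw′ w′∈R) in
          false≢true (trans (sym w′≢w) (trans (sym Tv≡⁅w⁆w′) (trans (cong T v≡t) Tt))))
  ... | inj₁ R⊆w with R w in Rw
  ...   | true  = inj₂ (WinsFrom-cong t≁w (λ _ → refl) (sym ∘ ⊆⁅⁆⇒≗ R⊆w Rw))
  ...   | false = inj₁ (unmatched-vertexᴳ t λ w′ Tt≡⁅w⁆w′ ⁅t⁆t≡Rw′ →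
          let w′≡w = ⁅⁆-≡ (trans (sym Tt≡⁅w⁆w′) Tt) in
          false≢true (trans (sym Rw) (trans (cong R (sym w′≡w)) (trans (sym ⁅t⁆t≡Rw′) (⁅⁆-self t)))))

-- ∀ pins w down; ∃ must answer with vertices t agreeing with w on (X , Y).
pinᴴ : ∀ {G H} (X : Subset G) (Y : Subset H) (w : V H) →
       (∀ t → X t ≡ Y w → Distinguishable G H t w) → WinsFrom G H X Y
pinᴴ {G} {H} X Y w near = paintᴴ ⁅ w ⁆ respond
  where
  respond : ∀ T → ImmediateWin G H X Y T ⁅ w ⁆ ⊎ WinsFrom G H T ⁅ w ⁆
  respond T with ⊆-or-escape T (λ v → does (X v ≟ᵇ Y w))
  ... | inj₂ (v , Tv , Xv≢Yw) = inj₁ (unmatched-vertexᴳ v λ w′ Xv≡Yw′ Tv≡⁅w⁆w′ →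
          let w′≡w = ⁅⁆-≡ (trans (sym Tv≡⁅w⁆w′) Tv) in
          false≢true (trans (sym Xv≢Yw) (dec-true (X v ≟ᵇ Y w) (trans Xv≡Yw′ (cong Y w′≡w)))))
  ... | inj₁ T⊆[X≡Yw] with empty-or-inhabited T
  ...   | inj₁ T-empty = inj₁ (unmatched-vertexᴴ w λ v _ Tv≡⁅w⁆w →
          false≢true (trans (sym (T-empty v)) (trans Tv≡⁅w⁆w (⁅⁆-self w))))
  ...   | inj₂ (t , Tt) = inj₂ (select-pointᴳ Tt (near t (does≡true⇒ (X t ≟ᵇ Y w) (T⊆[X≡Yw] t Tt))))

Separating : (G H : Digraph) → Subset G → Subset H → Set
Separating G H CG CH = ∀ t w → CG t ≢ CH w → Distinguishable G H t w

Separating-sym : ∀ {G H CG CH} → Separating G H CG CH → Separating H G CH CG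
Separating-sym sep w t CHw≢CGt = Distinguishable-sym (sep t w (CHw≢CGt ∘ sym))

-- ∀ paints CG; unless ∃ answers with CH, he pins a vertex where her answer errs.
unbalanced⇒wins : ∀ {G H CG CH} → Separating G H CG CH → ∣ CG ∣ ≢ ∣ CH ∣ → ∀ X Y → WinsFrom G H X Y
unbalanced⇒wins {G} {H} {CG} {CH} sep CG≢CH X Y = paintᴳ CG λ D → inj₂ (respond D)
  where
  respond : ∀ D → WinsFrom G H CG D
  respond D with ≗-or-differ D CH
  ... | inj₁ D≗CH        = ∣∣≢⇒wins (CG≢CH ∘ flip trans (∣∣-cong D≗CH))
  ... | inj₂ (w , Dw≢CHw) = pinᴴ CG D w λ t CGt≡Dw →
                              sep t w λ CGt≡CHw → Dw≢CHw (trans (sym CGt≡Dw) CGt≡CHw)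

-- Distinguishing vertices with different tallies

Forced : ∀ {G H} → V G → V H → Subset G → Subset H → Set
Forced {G} {H} t w NG NH = ∀ S → NG ⊆ S → ∀ U → ImmediateWin G H ⁅ t ⁆ ⁅ w ⁆ S U ⊎ NH ⊆ U

in-neighbours-forced : ∀ G H (t : V G) (w : V H) → Forced t w (λ u → E G u t) (λ u → E H u w)
in-neighbours-forced G H t w S N⊆S U with ⊆-or-escape (λ u → E H u w) U
... | inj₁ N⊆U          = inj₂ N⊆U
... | inj₂ (x , xw , Ux) = inj₁ (unmatched-edgeᴴ {G} {H} {⁅ t ⁆} {⁅ w ⁆} {S} {U}
        x w xw λ u′ v′ _ Su′≡Ux ⁅t⁆v′≡⁅w⁆w _ u′v′ →
        let v′≡t = ⁅⁆-≡ (trans ⁅t⁆v′≡⁅w⁆w (⁅⁆-self w)) in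
        false≢true (trans (sym Ux) (trans (sym Su′≡Ux) (N⊆S u′ (subst (λ z → E G u′ z ≡ true) v′≡t u′v′)))))

out-neighbours-forced : ∀ G H (t : V G) (w : V H) → Forced t w (λ u → E G t u) (λ u → E H w u)
out-neighbours-forced G H t w S N⊆S U with ⊆-or-escape (λ u → E H w u) U
... | inj₁ N⊆U          = inj₂ N⊆U
... | inj₂ (x , wx , Ux) = inj₁ (unmatched-edgeᴴ {G} {H} {⁅ t ⁆} {⁅ w ⁆} {S} {U}
        w x wx λ u′ v′ ⁅t⁆u′≡⁅w⁆w _ _ Sv′≡Ux u′v′ →
        let u′≡t = ⁅⁆-≡ (trans ⁅t⁆u′≡⁅w⁆w (⁅⁆-self w)) in
        false≢true (trans (sym Ux) (trans (sym Sv′≡Ux) (N⊆S v′ (subst (λ z → E G z v′ ≡ true) u′≡t u′v′)))))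

complement-< : ∀ {a b c d} → a + b ≡ c + d → a < c → d < b
complement-< {a} {b} {c} {d} a+b≡c+d a<c =
  ℕ.+-cancelˡ-< c d b (subst (_< c + b) a+b≡c+d (ℕ.+-monoˡ-< b a<c))

-- ∀ paints NG together with everything outside CG. ∃ must cover NH, so the
-- complement of her answer lies in CH ∖ NH, which is smaller than CG ∖ NG.
forced-<⇒distinguishable : ∀ {G H} {t : V G} {w : V H} {CG NG : Subset G} {CH NH : Subset H} →
  Separating G H CG CH → Forced t w NG NH →
  ∣ (λ u → CG u ∧ NG u) ∣ < ∣ (λ u → CH u ∧ NH u) ∣ → Distinguishable G H t w
forced-<⇒distinguishable {G} {H} {t} {w} {CG} {NG} {CH} {NH} sep forced ∣CG∩NG∣<∣CH∩NH∣
  with ∣ CG ∣ ℕ.≟ ∣ CH ∣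
... | no CG≢CH  = unbalanced⇒wins sep CG≢CH _ _
... | yes CG≡CH = paintᴳ S respond
  where
  CG∖NG : Subset G
  CG∖NG u = CG u ∧ not (NG u)

  S : Subset G
  S = not ∘ CG∖NG

  NG⊆S : NG ⊆ S
  NG⊆S u NGu = trans (cong (λ b → not (CG u ∧ not b)) NGu) (cong not (∧-zeroʳ (CG u)))

  ∣CH∖NH∣<∣CG∖NG∣ : ∣ (λ u → CH u ∧ not (NH u)) ∣ < ∣ CG∖NG ∣
  ∣CH∖NH∣<∣CG∖NG∣ =
    complement-< (trans (sym (∣∣-split CG NG)) (trans CG≡CH (∣∣-split CH NH))) ∣CG∩NG∣<∣CH∩NH∣

  respond : ∀ U → ImmediateWin G H ⁅ t ⁆ ⁅ w ⁆ S U ⊎ WinsFrom G H S U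
  respond U with forced S NG⊆S U
  ... | inj₁ win  = inj₁ win
  ... | inj₂ NH⊆U with ⊆-or-escape (not ∘ U) CH
  ...   | inj₂ (w′ , ¬Uw′ , CHw′) = inj₂ (pinᴴ S U w′ λ t′ St′≡Uw′ → sep t′ w′ λ CGt′≡CHw′ →
            let CG∖NGt′ = not-injective (trans St′≡Uw′ (not-injective ¬Uw′)) in
            false≢true (trans (sym CHw′) (trans (sym CGt′≡CHw′) (∧-conicalˡ _ _ CG∖NGt′))))
  ...   | inj₁ ¬U⊆CH = inj₂ (wins-complement (∣∣≢⇒wins λ ¬S≡¬U → ℕ.<⇒≢ ¬U<¬S (sym ¬S≡¬U)))
    where
    ¬U⊆CH∖NH : (not ∘ U) ⊆ (λ u → CH u ∧ not (NH u))
    ¬U⊆CH∖NH u ¬Uu = cong₂ _∧_ (¬U⊆CH u ¬Uu)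
      (cong not (¬-not λ NHu → false≢true (trans (sym (not-injective ¬Uu)) (NH⊆U u NHu))))

    ¬U<¬S : ∣ not ∘ U ∣ < ∣ not ∘ S ∣
    ¬U<¬S = ℕ.≤-<-trans (∣∣-mono ¬U⊆CH∖NH)
              (subst (∣ (λ u → CH u ∧ not (NH u)) ∣ <_) (∣∣-cong (sym ∘ not-involutive ∘ CG∖NG))
                     ∣CH∖NH∣<∣CG∖NG∣)

forced-≢⇒distinguishable : ∀ {G H} {t : V G} {w : V H} {CG NG : Subset G} {CH NH : Subset H} →
  Separating G H CG CH → Forced t w NG NH → Forced w t NH NG →
  ∣ (λ u → CG u ∧ NG u) ∣ ≢ ∣ (λ u → CH u ∧ NH u) ∣ → Distinguishable G H t w
forced-≢⇒distinguishable {CG = CG} {NG} {CH} {NH} sep forced forced′ ≢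
  with ℕ.<-cmp ∣ (λ u → CG u ∧ NG u) ∣ ∣ (λ u → CH u ∧ NH u) ∣
... | tri< < _ _ = forced-<⇒distinguishable sep forced <
... | tri≈ _ ≡ _ = ⊥-elim (≢ ≡)
... | tri> _ _ > = Distinguishable-sym (forced-<⇒distinguishable (Separating-sym sep) forced′ >)

τ-≢⇒distinguishable : ∀ {G H} {CG : Subset G} {CH : Subset H} {t : V G} {w : V H} →
  Separating G H CG CH → τ G CG t ≢ τ H CH w → Distinguishable G H t w
τ-≢⇒distinguishable {G} {H} {CG} {CH} {t} {w} sep τ≢
  with ∣ (λ u → CG u ∧ E G u t) ∣ ℕ.≟ ∣ (λ u → CH u ∧ E H u w) ∣
... | no in≢  = forced-≢⇒distinguishable sep (in-neighbours-forced G H t w) (in-neighbours-forced H G w t) in≢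
... | yes in≡ = forced-≢⇒distinguishable sep (out-neighbours-forced G H t w) (out-neighbours-forced H G w t)
                  λ out≡ → τ≢ (cong₂ _,_ (as-count in≡) (as-count out≡))
  where
  as-count : ∀ {p : Subset G} {q : Subset H} → ∣ p ∣ ≡ ∣ q ∣ → count G p ≡ count H q
  as-count {p} {q} ∣p∣≡∣q∣ = trans (count≡∣∣ G p) (trans ∣p∣≡∣q∣ (sym (count≡∣∣ H q)))

_≟ᵛ_ : ∀ {k} → DecidableEquality (Vec (ℕ × ℕ) k)
_≟ᵛ_ = Vec.≡-dec _≟²_

hasPrefix : (G : Digraph) (k : ℕ) → Vec (ℕ × ℕ) (suc k) → Subset G
hasPrefix G k σ u = does (prefix G k u ≟ᵛ σ)

class : (G : Digraph) → ℕ → V G → Subset G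
class G k v = hasPrefix G k (prefix G k v)

prefix-≢⇒distinguishable : ∀ {G H} k (t : V G) (w : V H) →
  prefix G k t ≢ prefix H k w → Distinguishable G H t w
prefix-≢⇒distinguishable zero t w τ≢ =
  τ-≢⇒distinguishable (λ _ _ true≢true → ⊥-elim (true≢true refl)) (τ≢ ∘ cong [_])
prefix-≢⇒distinguishable {G} {H} (suc k) t w prefix≢ with prefix G k t ≟ᵛ prefix H k w
... | no  prefix≢ₖ = prefix-≢⇒distinguishable k t w prefix≢ₖ
... | yes prefix≡ₖ = τ-≢⇒distinguishable separating (prefix≢ ∘ flip (cong₂ _∷_) prefix≡ₖ)
  where
  separating : Separating G H (class G k t) (class H k w)
  separating t′ w′ class≢ = prefix-≢⇒distinguishable k t′ w′ λ prefix≡ →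
    class≢ (cong₂ (λ a b → does (a ≟ᵛ b)) prefix≡ prefix≡ₖ)

-- Stabilisation of the tally refinement

does-⇔ : ∀ {P Q : Set} (P? : Dec P) (Q? : Dec Q) → (P → Q) → (Q → P) → does P? ≡ does Q?
does-⇔ (yes _) (yes _) _   _   = refl
does-⇔ (yes p) (no ¬q) P⇒Q _   = ⊥-elim (¬q (P⇒Q p))
does-⇔ (no ¬p) (yes q) _   Q⇒P = ⊥-elim (¬p (Q⇒P q))
does-⇔ (no _)  (no _)  _   _   = refl

τ-cong : ∀ G {Y Y′ : Subset G} v → Y ≗ Y′ → τ G Y v ≡ τ G Y′ v
τ-cong G v Y≗Y′ =
  cong₂ _,_ (count-cong λ u → cong (_∧ E G u v) (Y≗Y′ u)) (count-cong λ u → cong (_∧ E G v u) (Y≗Y′ u))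
  where
  count-cong : ∀ {p q : Subset G} → p ≗ q → count G p ≡ count G q
  count-cong {p} {q} p≗q = trans (count≡∣∣ G p) (trans (∣∣-cong p≗q) (sym (count≡∣∣ G q)))

class-suc⊆class : ∀ G k v → class G (suc k) v ⊆ class G k v
class-suc⊆class G k v u u∈class = dec-true (prefix G k u ≟ᵛ prefix G k v)
  (∷-injectiveʳ (does≡true⇒ (prefix G (suc k) u ≟ᵛ prefix G (suc k) v) u∈class))

Stable : Digraph → ℕ → Set
Stable G k = ∀ u v → prefix G k u ≡ prefix G k v → prefix G (suc k) u ≡ prefix G (suc k) v

tallySeq-stable : ∀ {G k} → Stable G k → ∀ v → tallySeq G v (suc (suc k)) ≡ tallySeq G v (suc k)
tallySeq-stable {G} {k} stable v =
  τ-cong G v λ u → does-⇔ (prefix G (suc k) u ≟ᵛ prefix G (suc k) v) (prefix G k u ≟ᵛ prefix G k v)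
                           ∷-injectiveʳ (stable u v)

Stable-suc : ∀ {G k} → Stable G k → Stable G (suc k)
Stable-suc stable u v prefix≡ =
  cong₂ _∷_ (trans (tallySeq-stable stable u) (trans (∷-injectiveˡ prefix≡) (sym (tallySeq-stable stable v))))
            prefix≡

Stable-+ : ∀ {G k} → Stable G k → ∀ d → Stable G (d + k)
Stable-+ stable zero    = stable
Stable-+ stable (suc d) = Stable-suc (Stable-+ stable d)

agreeing-pairs : Digraph → ℕ → ℕ
agreeing-pairs G k = sum λ v → ∣ class G k v ∣

stable-or-refines : ∀ G k → Stable G k ⊎ agreeing-pairs G (suc k) < agreeing-pairs G k
stable-or-refines G k
  with some-or-all (size G) (λ v → Sum.swap (⊆-or-escape (class G k v) (class G (suc k) v)))
... | inj₁ (v , u , u∈classₖ , u∉class₁₊ₖ) = inj₂ (sum-mono-< (∣∣-mono ∘ class-suc⊆class G k) v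
                                                 (∣∣-mono-< (class-suc⊆class G k v) u u∉class₁₊ₖ u∈classₖ))
... | inj₂ class⊆class-suc =
  inj₁ λ u v prefix≡ → does≡true⇒ (_ ≟ᵛ _) (class⊆class-suc v u (dec-true (_ ≟ᵛ _) prefix≡))

stable-level : ∀ G → ∃ (Stable G)
stable-level G = descend (suc (agreeing-pairs G 0)) 0 ℕ.≤-refl
  where
  descend : ∀ n k → agreeing-pairs G k < n → ∃ (Stable G)
  descend (suc n) k bound with stable-or-refines G k
  ... | inj₁ stable  = k , stable
  ... | inj₂ refines = descend n (suc k) (ℕ.<-≤-trans refines (ℕ.≤-pred bound))

common-stable-level : ∀ G H → ∃ λ k → Stable G k × Stable H k
common-stable-level G H with stable-level G | stable-level H
... | kG , G-stable | kH , H-stable =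
  kH + kG , Stable-+ G-stable kH , subst (Stable H) (ℕ.+-comm kG kH) (Stable-+ H-stable kG)

tallySeq-constant : ∀ {G k} → Stable G k → ∀ v d → tallySeq G v (d + suc k) ≡ tallySeq G v (suc k)
tallySeq-constant         stable v zero    = refl
tallySeq-constant {G} {k} stable v (suc d) = trans
  (subst (λ n → tallySeq G v (suc n) ≡ tallySeq G v n) (sym (ℕ.+-suc d k))
         (tallySeq-stable (Stable-+ stable d) v))
  (tallySeq-constant stable v d)

prefix-≡-drop : ∀ {G H v w} d k → prefix G (d + k) v ≡ prefix H (d + k) w → prefix G k v ≡ prefix H k w
prefix-≡-drop zero    k prefix≡ = prefix≡
prefix-≡-drop (suc d) k prefix≡ = prefix-≡-drop d k (∷-injectiveʳ prefix≡)

prefix-≡⇒tallySeq-≡ : ∀ {G H k} → Stable G k → Stable H k → ∀ {v w} →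
  prefix G (suc k) v ≡ prefix H (suc k) w → ∀ n → tallySeq G v n ≡ tallySeq H w n
prefix-≡⇒tallySeq-≡ {G} {H} {k} G-stable H-stable {v} {w} prefix≡ n with n ≤? suc k
... | yes n≤1+k = cong head (prefix-≡-drop (suc k ∸ n) n
                    (subst (λ m → prefix G m v ≡ prefix H m w) (sym (ℕ.m∸n+n≡m n≤1+k)) prefix≡))
... | no  n≰1+k = subst (λ m → tallySeq G v m ≡ tallySeq H w m) (ℕ.m∸n+n≡m (ℕ.<⇒≤ (ℕ.≰⇒> n≰1+k)))
                    (trans (tallySeq-constant G-stable v (n ∸ suc k))
                      (trans (cong head prefix≡) (sym (tallySeq-constant H-stable w (n ∸ suc k)))))

fibre-nonempty : ∀ {A : Set} (_≟_ : DecidableEquality A) {n} (f : Fin n → A) i →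
                 0 < ∣ (λ j → does (f j ≟ f i)) ∣
fibre-nonempty _≟_ f i = ∣∣-nonempty _ i (dec-true (f i ≟ f i) refl)

fibres-≡⇒↔ : ∀ {A : Set} (_≟_ : DecidableEquality A) {n m} (f : Fin n → A) (g : Fin m → A) →
  (∀ a → ∣ (λ i → does (f i ≟ a)) ∣ ≡ ∣ (λ j → does (g j ≟ a)) ∣) →
  Σ (Fin n ↔ Fin m) λ π → ∀ i → f i ≡ g (Inverse.to π i)
fibres-≡⇒↔ _≟_ {zero}  {zero}  f g same = ↔-id _ , λ ()
fibres-≡⇒↔ _≟_ {zero}  {suc m} f g same = ⊥-elim (ℕ.<⇒≢ (fibre-nonempty _≟_ g zero) (same (g zero)))
fibres-≡⇒↔ _≟_ {suc n} {zero}  f g same = ⊥-elim (ℕ.<⇒≢ (fibre-nonempty _≟_ f zero) (sym (same (f zero))))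
fibres-≡⇒↔ _≟_ {suc n} {suc m} f g same with empty-or-inhabited (λ j → does (g j ≟ f zero))
... | inj₁ none = ⊥-elim (ℕ.<⇒≢ (fibre-nonempty _≟_ f zero) (sym (trans (same (f zero)) (∣∣-empty none))))
... | inj₂ (j , gj≟f0) =
  Permutation.insert zero j (proj₁ rest) , λ { zero → sym gj≡f0 ; (suc i) → proj₂ rest i }
  where
  gj≡f0 : g j ≡ f zero
  gj≡f0 = does≡true⇒ (g j ≟ f zero) gj≟f0

  same′ : ∀ a → ∣ (λ i → does (f (suc i) ≟ a)) ∣ ≡ ∣ (λ i → does (g (punchIn j i) ≟ a)) ∣
  same′ a = ℕ.+-cancelˡ-≡ (bit (does (f zero ≟ a))) _ _
    (trans (same a) (trans (sum-remove {i = j} (λ i → bit (does (g i ≟ a))))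
                           (cong (λ x → bit (does (x ≟ a)) + ∣ (λ i → does (g (punchIn j i) ≟ a)) ∣) gj≡f0)))

  rest = fibres-≡⇒↔ _≟_ (f ∘ suc) (g ∘ punchIn j) same′

BalancedAt : Digraph → Digraph → (k : ℕ) → Vec (ℕ × ℕ) (suc k) → Set
BalancedAt G H k σ = ∣ hasPrefix G k σ ∣ ≡ ∣ hasPrefix H k σ ∣

Balanced : Digraph → Digraph → ℕ → Set
Balanced G H k = ∀ σ → BalancedAt G H k σ

balanced-or-witness : ∀ G H k → Balanced G H k ⊎ ∃ λ σ → ¬ BalancedAt G H k σ
balanced-or-witness G H k with some-or-all (size G) (balanced-at ∘ prefix G k)
                             | some-or-all (size H) (balanced-at ∘ prefix H k)
  where
  balanced-at : ∀ σ → ¬ BalancedAt G H k σ ⊎ BalancedAt G H k σ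
  balanced-at σ = Sum.swap (toSum (∣ hasPrefix G k σ ∣ ℕ.≟ ∣ hasPrefix H k σ ∣))
... | inj₁ (v , unbalanced) | _                     = inj₂ (_ , unbalanced)
... | inj₂ _                | inj₁ (w , unbalanced) = inj₂ (_ , unbalanced)
... | inj₂ at-G             | inj₂ at-H             = inj₁ balanced
  where
  balanced : Balanced G H k
  balanced σ with empty-or-inhabited (hasPrefix G k σ) | empty-or-inhabited (hasPrefix H k σ)
  ... | inj₂ (v , v∈σ)  | _              = subst (BalancedAt G H k) (does≡true⇒ (_ ≟ᵛ σ) v∈σ) (at-G v)
  ... | inj₁ _          | inj₂ (w , w∈σ) = subst (BalancedAt G H k) (does≡true⇒ (_ ≟ᵛ σ) w∈σ) (at-H w)
  ... | inj₁ G-none     | inj₁ H-none    = trans (∣∣-empty G-none) (sym (∣∣-empty H-none))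

balanced⇒same-spectrum : ∀ {G H k} → Stable G k → Stable H k → Balanced G H (suc k) → SameTallySpectrum G H
balanced⇒same-spectrum {G} {H} {k} G-stable H-stable balanced
  with fibres-≡⇒↔ _≟ᵛ_ (prefix G (suc k)) (prefix H (suc k)) balanced
... | π , prefix≡ = π , λ v → prefix-≡⇒tallySeq-≡ G-stable H-stable (prefix≡ v)

hasPrefix-separating : ∀ G H k σ → Separating G H (hasPrefix G k σ) (hasPrefix H k σ)
hasPrefix-separating G H k σ t w class≢ =
  prefix-≢⇒distinguishable k t w λ prefix≡ → class≢ (cong (λ ρ → does (ρ ≟ᵛ σ)) prefix≡)

corollary4p6 : (G H : Digraph) → ¬ SameTallySpectrum G H → ForallHasWinningStrategy 2 G H
corollary4p6 G H different with common-stable-level G H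
... | k , G-stable , H-stable with balanced-or-witness G H (suc k)
...   | inj₁ balanced          = ⊥-elim (different (balanced⇒same-spectrum G-stable H-stable balanced))
...   | inj₂ (σ , unbalanced) =
  unbalanced⇒wins (hasPrefix-separating G H (suc k) σ) unbalanced _ _ zero initial (λ _ → refl) (λ _ → refl)
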